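{- Let $C$ be a cycle with vertices $v_1,\dots,v_k$, let $I\subseteq\{1,\dots,k\}$, and for each $i\in I$ let $T_i$ be a subcubic tree with at least two vertices; let $G$ be the graph obtained from the disjoint union of $C$ and the trees $T_i$ ($i\in I$) by identifying, for each $i\in I$, a leaf of $T_i$ with the vertex $v_i$. Then $G$ admits a crumby coloring.
   Context: A graph is subcubic if it has maximum degree at most $3$; a leaf is a vertex of degree $1$. A crumby coloring of a graph $H$ is a coloring of the vertices of $H$ with two colors, red and blue, such that the subgraph induced by the blue vertices has maximum degree at most $1$, and the subgraph induced by the red vertices has minimum degree at least $1$ and contains no path with $3$ edges. -}

module Defs where

open import Data.Nat using (ℕ; zero; suc; _+_; _≤_; _%_)
open import Data.Fin using (Fin; toℕ; _≟_)
open import Data.Bool using (Bool; true; false; if_then_else_; T)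
open import Data.List using (List; map; allFin)
open import Data.Nat.ListAction using (sum)
open import Data.Product using (Σ; Σ-syntax; _×_; _,_)
open import Data.Sum using (_⊎_; inj₁; inj₂)
open import Data.Empty using (⊥)
open import Relation.Nullary using (¬_; yes; no)
open import Relation.Nullary.Decidable using (False; fromWitnessFalse)
open import Relation.Binary.PropositionalEquality using (_≡_; _≢_)
open import Function.Definitions using (Injective)

CycAdj : (k : ℕ) → Fin k → Fin k → Set
CycAdj zero () _
CycAdj (suc n) a b =
  (toℕ b ≡ suc (toℕ a) % suc n) ⊎ (toℕ a ≡ suc (toℕ b) % suc n)

record FinGraph : Set where
  field
    size  : ℕ
    adj   : Fin size → Fin size → Bool
    symm  : ∀ x y → adj x y ≡ adj y x
    irrfl : ∀ x → adj x x ≡ false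

  degree : Fin size → ℕ
  degree x = sum (map (λ y → if adj x y then 1 else 0) (allFin size))

  data Walk : Fin size → Fin size → Set where
    here : ∀ {x} → Walk x x
    step : ∀ {x y z} → adj x y ≡ true → Walk y z → Walk x z

  Connected : Set
  Connected = ∀ x y → Walk x y

  HasCycle : Set
  HasCycle = Σ[ L ∈ ℕ ] (3 ≤ L × Σ[ f ∈ (Fin L → Fin size) ]
               (Injective _≡_ _≡_ f × (∀ a b → CycAdj L a b → adj (f a) (f b) ≡ true)))

  IsTree : Set
  IsTree = Connected × ¬ HasCycle

  Subcubic : Set
  Subcubic = ∀ x → degree x ≤ 3

  IsLeaf : Fin size → Set
  IsLeaf x = degree x ≡ 1

open FinGraph public using (Walk; here; step)

-- Crumby colorings of a graph given by a vertex type and adjacency relation.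
-- true = red, false = blue.

record Crumby {V : Set} (Adj : V → V → Set) (c : V → Bool) : Set where
  field
    -- blue induced subgraph has maximum degree ≤ 1
    blueDeg : ∀ u w x → c u ≡ false → c w ≡ false → c x ≡ false →
              Adj u w → Adj u x → w ≡ x
    redDeg  : ∀ u → c u ≡ true → Σ[ w ∈ V ] (c w ≡ true × Adj u w)
    -- red induced subgraph has no path with 3 edges
    noP4    : ∀ a b d e → c a ≡ true → c b ≡ true → c d ≡ true → c e ≡ true →
              a ≢ b → a ≢ d → a ≢ e → b ≢ d → b ≢ e → d ≢ e →
              Adj a b → Adj b d → Adj d e → ⊥

HasCrumby : {V : Set} → (V → V → Set) → Set
HasCrumby {V} Adj = Σ[ c ∈ (V → Bool) ] Crumby Adj c

module Glue (k : ℕ) (I : Fin k → Bool)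
            (Tr : (i : Fin k) → T (I i) → FinGraph)
            (ℓ : (i : Fin k) → (p : T (I i)) → Fin (FinGraph.size (Tr i p))) where

  -- vertices: cycle vertices, plus non-leaf vertices of each attached tree
  data GV : Set where
    cyc  : Fin k → GV
    tree : (i : Fin k) (p : T (I i)) (x : Fin (FinGraph.size (Tr i p))) →
           False (x ≟ ℓ i p) → GV

  emb : (i : Fin k) (p : T (I i)) → Fin (FinGraph.size (Tr i p)) → GV
  emb i p x with x ≟ ℓ i p
  ... | yes _ = cyc i
  ... | no ne = tree i p x (fromWitnessFalse ne)

  data GAdj : GV → GV → Set where
    cycE  : ∀ {a b} → CycAdj k a b → GAdj (cyc a) (cyc b)
    treeE : ∀ i p x y → FinGraph.adj (Tr i p) x y ≡ true →
            GAdj (emb i p x) (emb i p y)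

-- Colour every vertex blue, or red as the hub or a spoke of a red star. Local conditions (a blue
-- vertex has at most one blue neighbour, a hub a red neighbour but no hub neighbour, a spoke exactly
-- one red neighbour and no spoke neighbour) force the red subgraph to be a disjoint union of stars
-- with at least one edge, so such a colouring is crumby.
--
-- Root each pendant tree at its leaf on the cycle. The profile of a vertex records which pairs
-- (role of the parent, own role) extend to the subtree below it; it is computed bottom-up from the
-- profiles of the at most two children, and all profiles lie in an explicit family of eight closed
-- under this step. Each profile gets a letter X, Y or Z describing the role triples along the cycle
-- that its tree can complete, Z also standing for a vertex without a tree. A cyclic word of length
-- at least three over these letters is coloured by cutting a rotation of it into a few blocks,
-- depending on whether it contains X, contains ZY as a cyclic factor, or is constant; the trees
-- are then coloured top-down along the choices recorded in their profiles.

module Submission where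

open import Defs hiding (Walk; here; step)

open import Data.Bool as Bool using (Bool; true; false; T; not; _∧_; _∨_; if_then_else_)
open import Data.Bool.ListAction using (any; all)
open import Data.Bool.Properties using (T-∧; T-∨; T-≡; T-irrelevant)
open import Data.Empty using (⊥; ⊥-elim)
open import Data.Fin as Fin using (Fin; toℕ; _≟_)
open import Data.Fin.Properties using (toℕ<n; toℕ-injective; toℕ-fromℕ; toℕ-fromℕ<; toℕ-inject₁)
open import Data.List using (List; []; _∷_; _++_; map; length; filterᵇ; allFin; tabulate; replicate;
  cartesianProductWith)
open import Data.List.Membership.Propositional using (_∈_; lose; find)
open import Data.List.Membership.Propositional.Properties
  using (∈-filter⁺; ∈-filter⁻; ∈-map⁺; ∈-map⁻; ∈-allFin; ∈-cartesianProductWith⁺)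
import Data.List.Membership.DecPropositional as Memberₚ
open import Data.List.Properties using (map-cong-local; map-cong; map-∘; ∷-injectiveˡ; length-map;
  ++-identityʳ; ++-assoc; length-++-sucʳ; length-++-comm; length-replicate; length-tabulate)
open import Data.List.Relation.Unary.All as All using (All; []; _∷_)
open import Data.List.Relation.Unary.All.Properties using (all⁺)
import Data.List.Relation.Unary.All.Properties as Allₚ
open import Data.List.Relation.Unary.Any using (here; there)
open import Data.List.Relation.Unary.Any.Properties using (any⁺; any⁻; map⁻)
open import Data.List.Relation.Unary.Unique.Propositional using (Unique; []; _∷_)
import Data.List.Relation.Unary.Unique.Propositional.Properties as Uniqueₚ
open import Data.Nat using (ℕ; zero; suc; pred; _+_; _∸_; _%_; _≤_; _<_; _≤?_; z≤n; s≤s; _≤ᵇ_; _≡ᵇ_)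
open import Data.Nat.DivMod using (m<n⇒m%n≡m; n%n≡0; m%n<n)
open import Data.Nat.ListAction using (sum)
open import Data.Nat.Properties using (≤ᵇ⇒≤; ≡ᵇ⇒≡; ≤-refl; ≤-antisym; ≤-pred; ≤-trans; ≤-reflexive;
  <⇒≤; <-irrefl; <-≤-trans; ≤-<-connex; <-≤-connex; n≤1+n; m≤n⇒m≤1+n; n≤0⇒n≡0; 1+n≰n;
  m≤n⇒m<n∨m≡n; m≤m+n; m≤n+m; suc-injective; +-identityʳ; +-suc; +-monoˡ-≤; +-cancelˡ-≡;
  +-cancelʳ-≡; +-cancelʳ-<; ∸-monoʳ-≤; ∸-monoʳ-<; ∸-cancelˡ-≡; m+n∸m≡n; n∸n≡0; module ≤-Reasoning)
open import Data.Product using (Σ-syntax; ∃-syntax; _×_; _,_; proj₁; proj₂)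
open import Data.Sum using (_⊎_; inj₁; inj₂)
open import Data.Unit using (tt)
open import Data.Vec as Vec using (Vec; []; _∷_)
import Data.Vec.Properties as Vec
open import Function using (_∘_)
open import Function.Bundles using (Equivalence)
open import Relation.Binary.Definitions using (DecidableEquality)
open import Relation.Binary.PropositionalEquality
  using (_≡_; _≢_; refl; sym; trans; cong; cong₂; subst; subst₂; module ≡-Reasoning)
open import Relation.Nullary using (¬_; Dec; yes; no)
open import Relation.Nullary.Decidable using (T?; False; isYes; dec-yes-irr; toWitness; fromWitness;
  toWitnessFalse; fromWitnessFalse; ¬?; _×-dec_)

open Equivalence using (to; from)

count : {A : Set} → (A → Bool) → List A → ℕ
count p xs = length (filterᵇ p xs)

module _ {A : Set} {p : A → Bool} where

  count-map : ∀ {B : Set} (f : B → A) xs → count p (map f xs) ≡ count (p ∘ f) xs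
  count-map f [] = refl
  count-map f (x ∷ xs) with p (f x)
  ... | true  = cong suc (count-map f xs)
  ... | false = count-map f xs

  count≤1⇒unique : ∀ {xs x y} → count p xs ≤ 1 → x ∈ xs → y ∈ xs → T (p x) → T (p y) → x ≡ y
  count≤1⇒unique {xs} c x∈ y∈ px py =
    at-most-one (filterᵇ p xs) c (∈-filter⁺ (T? ∘ p) x∈ px) (∈-filter⁺ (T? ∘ p) y∈ py)
    where
    at-most-one : ∀ ys {x y} → length ys ≤ 1 → x ∈ ys → y ∈ ys → x ≡ y
    at-most-one (_ ∷ []) _ (here refl) (here refl) = refl
    at-most-one (_ ∷ _ ∷ _) (s≤s ())

  0<count⇒witness : ∀ {xs} → 0 < count p xs → ∃[ x ] (x ∈ xs × T (p x))
  0<count⇒witness {xs} pos with filterᵇ p xs in eq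
  0<count⇒witness {xs} () | []
  ... | x ∷ _ = x , ∈-filter⁻ (T? ∘ p) (subst (x ∈_) (sym eq) (here refl))

  none⇒¬ : ∀ {xs x} → T (not (any p xs)) → x ∈ xs → T (p x) → ⊥
  none⇒¬ {xs} none x∈ px with any p xs | any⁺ p (lose x∈ px)
  ... | true | _ = none

  count-pos : ∀ {xs x} → x ∈ xs → T (p x) → 0 < count p xs
  count-pos x∈ px = nonempty (∈-filter⁺ (T? ∘ p) x∈ px)
    where
    nonempty : ∀ {x ys} → x ∈ ys → 0 < length ys
    nonempty (here _)  = s≤s z≤n
    nonempty (there _) = s≤s z≤n

  count-mono : ∀ {q : A → Bool} xs → (∀ {x} → T (p x) → T (q x)) → count p xs ≤ count q xs
  count-mono [] _ = z≤n
  count-mono {q} (x ∷ xs) p⇒q with p x in px | q x in qx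
  ... | true  | true  = s≤s (count-mono xs p⇒q)
  ... | true  | false = ⊥-elim (subst T qx (p⇒q (subst T (sym px) tt)))
  ... | false | true  = m≤n⇒m≤1+n (count-mono xs p⇒q)
  ... | false | false = count-mono xs p⇒q

  count-∨ : ∀ {q : A → Bool} xs → (∀ {x} → T (p x) → T (q x) → ⊥) →
            count (λ x → p x ∨ q x) xs ≡ count p xs + count q xs
  count-∨ [] _ = refl
  count-∨ {q} (x ∷ xs) disjoint with p x in px | q x in qx
  ... | true  | true  = ⊥-elim (disjoint (subst T (sym px) tt) (subst T (sym qx) tt))
  ... | true  | false = cong suc (count-∨ xs disjoint)
  ... | false | true  = trans (cong suc (count-∨ xs disjoint)) (sym (+-suc _ _))
  ... | false | false = count-∨ xs disjoint

  sum-indicator : ∀ xs → sum (map (λ x → if p x then 1 else 0) xs) ≡ count p xs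
  sum-indicator [] = refl
  sum-indicator (x ∷ xs) with p x
  ... | true  = cong suc (sum-indicator xs)
  ... | false = sum-indicator xs

first : {A : Set} → A → (A → Bool) → List A → A
first d p []       = d
first d p (x ∷ xs) = if p x then x else first d p xs

first-satisfies : ∀ {A : Set} {d : A} (p : A → Bool) xs → T (any p xs) → T (p (first d p xs))
first-satisfies p (x ∷ xs) h with p x in px
... | true  = subst T (sym px) tt
... | false = first-satisfies p xs h

tuples : {A : Set} → List A → ℕ → List (List A)
tuples xs zero    = [] ∷ []
tuples xs (suc n) = cartesianProductWith _∷_ xs (tuples xs n)

∈-tuples : ∀ {A : Set} {xs : List A} ys → All (_∈ xs) ys → ys ∈ tuples xs (length ys)
∈-tuples []       []          = here refl
∈-tuples (y ∷ ys) (y∈ ∷ ys∈) = ∈-cartesianProductWith⁺ _∷_ y∈ (∈-tuples ys ys∈)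

pointwise : {A B : Set} → (A → B → Bool) → List A → List B → Bool
pointwise R []       []       = true
pointwise R (a ∷ as) (b ∷ bs) = R a b ∧ pointwise R as bs
pointwise R _        _        = false

pointwise-length : ∀ {A B : Set} {R : A → B → Bool} as bs → T (pointwise R as bs) → length as ≡ length bs
pointwise-length []       []       _ = refl
pointwise-length (a ∷ as) (b ∷ bs) h = cong suc (pointwise-length as bs (proj₂ (to T-∧ h)))

pointwise-singleton : ∀ {A B : Set} (R : A → B → Bool) {a b} → T (R a b) → T (pointwise R (a ∷ []) (b ∷ []))
pointwise-singleton R {a} {b} h = from (T-∧ {R a b}) (h , tt)

implies : ∀ {a b} → T (not a ∨ b) → T a → T b
implies {true} h _ = h

∈⇒≤sum : ∀ {n ns} → n ∈ ns → n ≤ sum ns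
∈⇒≤sum {ns = m ∷ ns} (here refl) = m≤m+n m (sum ns)
∈⇒≤sum {ns = m ∷ ns} (there n∈)  = ≤-trans (∈⇒≤sum n∈) (m≤n+m (sum ns) m)

∸-suc : ∀ m {n} → n < m → m ∸ n ≡ suc (m ∸ suc n)
∸-suc (suc m) {zero}  _         = refl
∸-suc (suc m) {suc n} (s≤s n<m) = ∸-suc m n<m

least : (ℕ → Bool) → ℕ → ℕ
least p zero    = zero
least p (suc b) = if p zero then zero else suc (least (p ∘ suc) b)

least-satisfies : ∀ (p : ℕ → Bool) b {n} → n ≤ b → T (p n) → T (p (least p b))
least-satisfies p zero z≤n pn = pn
least-satisfies p (suc b) {n} n≤b pn with p zero in p0
least-satisfies p (suc b) {n} n≤b pn | true = subst T (sym p0) tt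
least-satisfies p (suc b) {zero} n≤b pn | false = ⊥-elim (subst T p0 pn)
least-satisfies p (suc b) {suc n} (s≤s n≤b) pn | false = least-satisfies (p ∘ suc) b n≤b pn

least-≤ : ∀ (p : ℕ → Bool) b {n} → T (p n) → least p b ≤ n
least-≤ p zero pn = z≤n
least-≤ p (suc b) {n} pn with p zero in p0
least-≤ p (suc b) {n} pn | true = z≤n
least-≤ p (suc b) {zero} pn | false = ⊥-elim (subst T p0 pn)
least-≤ p (suc b) {suc n} pn | false = s≤s (least-≤ (p ∘ suc) b pn)

least-bounded : ∀ (p : ℕ → Bool) b → least p b ≤ b
least-bounded p zero = z≤n
least-bounded p (suc b) with p zero
... | true  = z≤n
... | false = s≤s (least-bounded (p ∘ suc) b)

-- Local validity of roles

data Role : Set where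
  blue hub spoke : Role

isRed isBlue isHub isSpoke : Role → Bool
isRed blue = false
isRed _ = true
isBlue blue = true
isBlue _ = false
isHub hub = true
isHub _ = false
isSpoke spoke = true
isSpoke _ = false

Valid : Role → List Role → Bool
Valid blue  ns = count isBlue ns ≤ᵇ 1
Valid hub   ns = any isRed ns ∧ not (any isHub ns)
Valid spoke ns = (count isRed ns ≡ᵇ 1) ∧ not (any isSpoke ns)

module _ {V : Set} {Adj : V → V → Set} (Adj-sym : ∀ {u w} → Adj u w → Adj w u)
         (nbrs : V → List V)
         (nbrs-sound : ∀ {u w} → w ∈ nbrs u → Adj u w)
         (nbrs-complete : ∀ {u w} → Adj u w → w ∈ nbrs u)
         (role : V → Role) (valid : ∀ u → T (Valid (role u) (map role (nbrs u)))) where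

  red : V → Bool
  red = isRed ∘ role

  private
    count-nbrs : ∀ p u → count p (map role (nbrs u)) ≡ count (p ∘ role) (nbrs u)
    count-nbrs p u = count-map role (nbrs u)

    blue-unique : ∀ {u w x} → red u ≡ false → red w ≡ false → red x ≡ false →
                  Adj u w → Adj u x → w ≡ x
    blue-unique {u} {w} {x} ru rw rx uw ux with role u | valid u
    ... | blue | v = count≤1⇒unique {p = isBlue ∘ role}
                       (subst (_≤ 1) (count-nbrs isBlue u) (≤ᵇ⇒≤ _ 1 v))
                       (nbrs-complete uw) (nbrs-complete ux) (blue-of w rw) (blue-of x rx)
      where
      blue-of : ∀ y → red y ≡ false → T (isBlue (role y))
      blue-of y r with role y
      ... | blue = tt

    spoke-unique : ∀ {u w x} → role u ≡ spoke → red w ≡ true → red x ≡ true →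
                   Adj u w → Adj u x → w ≡ x
    spoke-unique {u} ru rw rx uw ux with role u | valid u
    ... | spoke | v = count≤1⇒unique {p = red}
                        (subst (_≤ 1) (trans (sym (≡ᵇ⇒≡ _ 1 (proj₁ (to T-∧ v)))) (count-nbrs isRed u)) (s≤s z≤n))
                        (nbrs-complete uw) (nbrs-complete ux) (from T-≡ rw) (from T-≡ rx)

    hubs-apart : ∀ {u w} → role u ≡ hub → role w ≡ hub → Adj u w → ⊥
    hubs-apart {u} {w} ru rw uw with role u | valid u
    ... | hub | v = none⇒¬ (proj₂ (to T-∧ v)) (∈-map⁺ role (nbrs-complete uw))
                      (subst (T ∘ isHub) (sym rw) tt)

    hub-or-spoke : ∀ u → red u ≡ true → role u ≡ hub ⊎ role u ≡ spoke
    hub-or-spoke u r with role u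
    ... | hub   = inj₁ refl
    ... | spoke = inj₂ refl

    red-neighbour : ∀ u → red u ≡ true → Σ[ w ∈ V ] (red w ≡ true × Adj u w)
    red-neighbour u r with role u | valid u
    ... | hub | v with find (map⁻ (any⁻ isRed (map role (nbrs u)) (proj₁ (to T-∧ v))))
    ... | w , w∈ , rw = w , to T-≡ rw , nbrs-sound w∈
    red-neighbour u r | spoke | v
      with 0<count⇒witness {p = red}
             (subst (0 <_) (sym (trans (sym (count-nbrs isRed u)) (≡ᵇ⇒≡ _ 1 (proj₁ (to T-∧ v))))) (s≤s z≤n))
    ... | w , w∈ , rw = w , to T-≡ rw , nbrs-sound w∈

    no-red-P₄ : ∀ a b d e → red a ≡ true → red b ≡ true → red d ≡ true → red e ≡ true →
                a ≢ d → b ≢ e → Adj a b → Adj b d → Adj d e → ⊥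
    no-red-P₄ a b d e ra rb rd re a≢d b≢e ab bd de with hub-or-spoke b rb | hub-or-spoke d rd
    ... | inj₂ b-spoke | _           = a≢d (spoke-unique b-spoke ra rd (Adj-sym ab) bd)
    ... | inj₁ _       | inj₂ d-spoke = b≢e (spoke-unique d-spoke rb re (Adj-sym bd) de)
    ... | inj₁ b-hub   | inj₁ d-hub   = hubs-apart b-hub d-hub bd

  crumby-of-valid : Crumby Adj red
  crumby-of-valid = record
    { blueDeg = λ u w x ru rw rx → blue-unique ru rw rx
    ; redDeg  = red-neighbour
    ; noP4    = λ a b d e ra rb rd re _ a≢d _ _ b≢e _ → no-red-P₄ a b d e ra rb rd re a≢d b≢e
    }

-- Profiles of pendant trees

roles : List Role
roles = blue ∷ hub ∷ spoke ∷ []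

∈-roles : ∀ v → v ∈ roles
∈-roles blue  = here refl
∈-roles hub   = there (here refl)
∈-roles spoke = there (there (here refl))

every-role : ∀ (p : Role → Bool) → T (all p roles) → ∀ v → T (p v)
every-role p h v = All.lookup (all⁺ p roles h) (∈-roles v)

all³ : (Role → Role → Role → Bool) → Bool
all³ P = all (λ a → all (λ v → all (P a v) roles) roles) roles

all³-elim : ∀ P → T (all³ P) → ∀ a v b → T (P a v b)
all³-elim P h a v b = every-role (P a v) (every-role (λ v → all (P a v) roles)
                        (every-role (λ a → all (λ v → all (P a v) roles) roles) h a) v) b

-- Row q, column v: may a vertex take role v below a parent of role q?
Profile : Set
Profile = Vec (Vec Bool 3) 3

slot : Role → Fin 3
slot blue  = Fin.zero
slot hub   = Fin.suc Fin.zero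
slot spoke = Fin.suc (Fin.suc Fin.zero)

allowed : Profile → Role → Role → Bool
allowed π q v = Vec.lookup (Vec.lookup π (slot q)) (slot v)

tabulateProfile : (Role → Role → Bool) → Profile
tabulateProfile f = Vec.map (λ q → Vec.map (f q) byRole) byRole
  where
  byRole : Vec Role 3
  byRole = blue ∷ hub ∷ spoke ∷ []

allowed-tabulate : ∀ f q v → allowed (tabulateProfile f) q v ≡ f q v
allowed-tabulate f blue  blue  = refl
allowed-tabulate f blue  hub   = refl
allowed-tabulate f blue  spoke = refl
allowed-tabulate f hub   blue  = refl
allowed-tabulate f hub   hub   = refl
allowed-tabulate f hub   spoke = refl
allowed-tabulate f spoke blue  = refl
allowed-tabulate f spoke hub   = refl
allowed-tabulate f spoke spoke = refl

Consistent : List Profile → Role → Role → List Role → Bool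
Consistent πs q v cs = pointwise (λ π c → allowed π v c) πs cs ∧ Valid v (q ∷ cs)

combine : List Profile → Profile
combine πs = tabulateProfile (λ q v → any (Consistent πs q v) (tuples roles (length πs)))

choose : List Profile → Role → Role → List Role
choose πs q v = first [] (Consistent πs q v) (tuples roles (length πs))

choose-consistent : ∀ πs {q v} → T (allowed (combine πs) q v) → T (Consistent πs q v (choose πs q v))
choose-consistent πs {q} {v} h =
  first-satisfies (Consistent πs q v) (tuples roles (length πs))
    (subst T (allowed-tabulate (λ q v → any (Consistent πs q v) (tuples roles (length πs))) q v) h)

-- Closed under combining at most two children, so it contains the profile of every non-root
-- vertex of a subcubic tree rooted at a leaf.
family : List Profile
family =
  ((true  ∷ true  ∷ true  ∷ []) ∷ (true  ∷ false ∷ true  ∷ []) ∷ (true  ∷ true  ∷ false ∷ []) ∷ []) ∷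
  ((true  ∷ true  ∷ true  ∷ []) ∷ (true  ∷ false ∷ false ∷ []) ∷ (true  ∷ true  ∷ false ∷ []) ∷ []) ∷
  ((true  ∷ true  ∷ false ∷ []) ∷ (true  ∷ false ∷ false ∷ []) ∷ (true  ∷ true  ∷ false ∷ []) ∷ []) ∷
  ((true  ∷ false ∷ true  ∷ []) ∷ (true  ∷ false ∷ true  ∷ []) ∷ (true  ∷ true  ∷ false ∷ []) ∷ []) ∷
  ((true  ∷ false ∷ false ∷ []) ∷ (true  ∷ false ∷ true  ∷ []) ∷ (true  ∷ true  ∷ false ∷ []) ∷ []) ∷
  ((false ∷ true  ∷ true  ∷ []) ∷ (true  ∷ false ∷ true  ∷ []) ∷ (true  ∷ true  ∷ false ∷ []) ∷ []) ∷
  ((false ∷ true  ∷ true  ∷ []) ∷ (true  ∷ false ∷ false ∷ []) ∷ (true  ∷ true  ∷ false ∷ []) ∷ []) ∷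
  ((false ∷ true  ∷ true  ∷ []) ∷ (false ∷ false ∷ true  ∷ []) ∷ (false ∷ true  ∷ false ∷ []) ∷ []) ∷
  []

_≟ₚ_ : DecidableEquality Profile
_≟ₚ_ = Vec.≡-dec (Vec.≡-dec Bool._≟_)

open Memberₚ _≟ₚ_ using () renaming (_∈?_ to _∈ₚ?_)

_∈ᶠ : Profile → Bool
π ∈ᶠ = isYes (π ∈ₚ? family)

closed₀ : T (combine [] ∈ᶠ)
closed₀ = tt

closed₁ : T (all (λ π → combine (π ∷ []) ∈ᶠ) family)
closed₁ = tt

closed₂ : T (all (λ π → all (λ σ → combine (π ∷ σ ∷ []) ∈ᶠ) family) family)
closed₂ = tt

∈ᶠ⇒∈ : ∀ π → T (π ∈ᶠ) → π ∈ family
∈ᶠ⇒∈ π = toWitness {a? = π ∈ₚ? family}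

combine-closed : ∀ πs → length πs ≤ 2 → All (_∈ family) πs → combine πs ∈ family
combine-closed []           _ []             = ∈ᶠ⇒∈ _ closed₀
combine-closed (π ∷ [])     _ (π∈ ∷ [])      =
  ∈ᶠ⇒∈ _ (All.lookup (all⁺ (λ π → combine (π ∷ []) ∈ᶠ) family closed₁) π∈)
combine-closed (π ∷ σ ∷ []) _ (π∈ ∷ σ∈ ∷ []) =
  ∈ᶠ⇒∈ _ (All.lookup (all⁺ (λ σ → combine (π ∷ σ ∷ []) ∈ᶠ) family
    (All.lookup (all⁺ (λ π → all (λ σ → combine (π ∷ σ ∷ []) ∈ᶠ) family) family closed₂) π∈)) σ∈)
combine-closed (_ ∷ _ ∷ _ ∷ _) (s≤s (s≤s ()))

-- The type of the tree hanging at a cycle vertex; Z also covers a vertex without a tree.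
data Letter : Set where
  X Y Z : Letter

-- admissible l a v b: role v is allowed at a cycle vertex of letter l whose cycle neighbours have
-- roles a and b. Letters are assigned to profiles so that every admissible triple extends into the tree.
admissible : Letter → Role → Role → Role → Bool
admissible X a blue  b = isRed a ∧ isRed b
admissible X a hub   b = not (isHub a) ∧ not (isHub b)
admissible X a spoke b = (isBlue a ∧ not (isSpoke b)) ∨ (isBlue b ∧ not (isSpoke a))
admissible Y a blue  b = isRed a ∨ isRed b
admissible Y a hub   b = not (isHub a) ∧ not (isHub b)
admissible Y a spoke b = isBlue a ∧ isBlue b
admissible Z a blue  b = isRed a ∨ isRed b
admissible Z a hub   b = (not (isHub a) ∧ not (isHub b)) ∧ (isSpoke a ∨ isSpoke b)
admissible Z a spoke b = (isBlue a ∧ isHub b) ∨ (isHub a ∧ isBlue b)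

Completion : Profile → Role → Role → Role → Role → Bool
Completion π a v b y = allowed π v y ∧ Valid v (a ∷ b ∷ y ∷ [])

completion-allowed : ∀ π a v b y → T (Completion π a v b y) → T (allowed π v y)
completion-allowed π a v b y h = proj₁ (to (T-∧ {allowed π v y}) h)

completion-valid : ∀ π a v b y → T (Completion π a v b y) → T (Valid v (a ∷ b ∷ y ∷ []))
completion-valid π a v b y h = proj₂ (to (T-∧ {allowed π v y}) h)

supports : Letter → Profile → Bool
supports l π = all³ (λ a v b → not (admissible l a v b) ∨ any (Completion π a v b) roles)

letter : Profile → Letter
letter π = if supports X π then X else if supports Y π then Y else Z

letter-supported : T (all (λ π → supports (letter π) π) family)
letter-supported = tt

Z-bare : T (all³ (λ a v b → not (admissible Z a v b) ∨ Valid v (a ∷ b ∷ [])))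
Z-bare = tt

letter-supports : ∀ {π} → π ∈ family → T (supports (letter π) π)
letter-supports π∈ = All.lookup (all⁺ (λ π → supports (letter π) π) family letter-supported) π∈

supported-completion : ∀ {l π} → T (supports l π) → ∀ {a v b} → T (admissible l a v b) →
                       T (any (Completion π a v b) roles)
supported-completion {l} {π} h {a} {v} {b} =
  implies (all³-elim (λ a v b → not (admissible l a v b) ∨ any (Completion π a v b) roles) h a v b)

bare-valid : ∀ {a v b} → T (admissible Z a v b) → T (Valid v (a ∷ b ∷ []))
bare-valid {a} {v} {b} =
  implies (all³-elim (λ a v b → not (admissible Z a v b) ∨ Valid v (a ∷ b ∷ [])) Z-bare a v b)

-- Colouring the cycle

headOr : Role → List Role → Role
headOr d []      = d
headOr d (c ∷ _) = c

lastOr : Role → List Role → Role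
lastOr d []       = d
lastOr d (c ∷ cs) = lastOr c cs

headOr-++ : ∀ d cs₁ cs₂ → headOr d (cs₁ ++ cs₂) ≡ headOr (headOr d cs₂) cs₁
headOr-++ d []      cs₂ = refl
headOr-++ d (c ∷ _) cs₂ = refl

lastOr-++ : ∀ d cs₁ cs₂ → lastOr d (cs₁ ++ cs₂) ≡ lastOr (lastOr d cs₁) cs₂
lastOr-++ d []        cs₂ = refl
lastOr-++ d (c ∷ cs₁) cs₂ = lastOr-++ c cs₁ cs₂

-- admits p ls cs q: a path with letters ls and roles cs, between neighbours of roles p and q.
admits : Role → List Letter → List Role → Role → Bool
admits p []       []       q = true
admits p (l ∷ ls) (c ∷ cs) q = admissible l p c (headOr q cs) ∧ admits c ls cs q
admits _ _        _        _ = false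

admits-length : ∀ {p q} ls cs → T (admits p ls cs q) → length ls ≡ length cs
admits-length []       []       _ = refl
admits-length (l ∷ ls) (c ∷ cs) h = cong suc (admits-length ls cs (proj₂ (to T-∧ h)))

admits-split : ∀ {p q} ls₁ cs₁ {ls₂ cs₂} →
               T (admits p (ls₁ ++ ls₂) (cs₁ ++ cs₂) q) → length ls₁ ≡ length cs₁ →
               T (admits p ls₁ cs₁ (headOr q cs₂)) × T (admits (lastOr p cs₁) ls₂ cs₂ q)
admits-split []        []        h refl = tt , h
admits-split {p} {q} (l ∷ ls₁) (c ∷ cs₁) {cs₂ = cs₂} h eq
  with to (T-∧ {admissible l p c (headOr q (cs₁ ++ cs₂))}) h
... | step , rest with admits-split ls₁ cs₁ rest (suc-injective eq)
...   | left , right = from T-∧ (subst (T ∘ admissible l p c) (headOr-++ q cs₁ cs₂) step , left) , right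

admits-join : ∀ {p q} ls₁ cs₁ {ls₂ cs₂} →
              T (admits p ls₁ cs₁ (headOr q cs₂)) → T (admits (lastOr p cs₁) ls₂ cs₂ q) →
              T (admits p (ls₁ ++ ls₂) (cs₁ ++ cs₂) q)
admits-join []        []        _ right = right
admits-join {p} {q} (l ∷ ls₁) (c ∷ cs₁) {cs₂ = cs₂} left right
  with to (T-∧ {admissible l p c (headOr (headOr q cs₂) cs₁)}) left
... | step , rest = from T-∧ (subst (T ∘ admissible l p c) (sym (headOr-++ q cs₁ cs₂)) step ,
                              admits-join ls₁ cs₁ rest right)

cyclic : List Letter → List Role → Bool
cyclic ls cs = admits (lastOr blue cs) ls cs (headOr blue cs)

Colourable : List Letter → Set
Colourable ls = ∃[ cs ] T (cyclic ls cs)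

cyclic-swap : ∀ ls₁ ls₂ cs₁ cs₂ → length ls₁ ≡ length cs₁ → length ls₂ ≡ length cs₂ →
              T (cyclic (ls₁ ++ ls₂) (cs₁ ++ cs₂)) → T (cyclic (ls₂ ++ ls₁) (cs₂ ++ cs₁))
cyclic-swap [] ls₂ [] cs₂ _ _ h =
  subst₂ (λ ls cs → T (cyclic ls cs)) (sym (++-identityʳ ls₂)) (sym (++-identityʳ cs₂)) h
cyclic-swap ls₁ [] cs₁ [] _ _ h =
  subst₂ (λ ls cs → T (cyclic ls cs)) (++-identityʳ ls₁) (++-identityʳ cs₁) h
cyclic-swap ls₁@(_ ∷ _) ls₂@(_ ∷ _) cs₁@(c ∷ cs₁′) cs₂@(d ∷ cs₂′) e₁ e₂ h
  with admits-split ls₁ cs₁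
         (subst (λ p → T (admits p (ls₁ ++ ls₂) (cs₁ ++ cs₂) c)) (lastOr-++ blue cs₁ cs₂) h) e₁
... | left , right = subst (λ p → T (admits p (ls₂ ++ ls₁) (cs₂ ++ cs₁) d)) (sym (lastOr-++ blue cs₂ cs₁))
                       (admits-join ls₂ cs₂ right left)

split-along : ∀ {A B : Set} (xs : List A) {ys : List A} (cs : List B) → length (xs ++ ys) ≡ length cs →
              ∃[ cs₁ ] ∃[ cs₂ ] (cs ≡ cs₁ ++ cs₂ × length xs ≡ length cs₁ × length ys ≡ length cs₂)
split-along []       cs       eq = [] , cs , refl , refl , eq
split-along (x ∷ xs) (c ∷ cs) eq with split-along xs cs (suc-injective eq)
... | cs₁ , cs₂ , refl , e₁ , e₂ = c ∷ cs₁ , cs₂ , refl , cong suc e₁ , e₂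

rotate : ∀ ls₁ ls₂ → Colourable (ls₂ ++ ls₁) → Colourable (ls₁ ++ ls₂)
rotate ls₁ ls₂ (cs , h) with split-along ls₂ cs (admits-length (ls₂ ++ ls₁) cs h)
... | cs₂ , cs₁ , refl , e₂ , e₁ = cs₁ ++ cs₂ , cyclic-swap ls₂ ls₁ cs₂ cs₁ e₂ e₁ h

record Tile (ls : List Letter) (cs : List Role) : Set where
  field
    starts-blue : headOr hub cs ≡ blue
    ends-red    : T (isRed (lastOr blue cs))
    admits-red  : ∀ {p} → T (isRed p) → T (admits p ls cs blue)

tile? : List Letter → List Role → Bool
tile? ls cs = isBlue (headOr hub cs) ∧ (isRed (lastOr blue cs) ∧ (admits hub ls cs blue ∧ admits spoke ls cs blue))

tile?-sound : ∀ ls cs → T (tile? ls cs) → Tile ls cs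
tile?-sound ls (blue ∷ cs) t with to (T-∧ {isRed (lastOr blue cs)}) t
... | red , both with to (T-∧ {admits hub ls (blue ∷ cs) blue}) both
...   | after-hub , after-spoke = record { starts-blue = refl ; ends-red = red ; admits-red = after-red }
  where
  after-red : ∀ {p} → T (isRed p) → T (admits p ls (blue ∷ cs) blue)
  after-red {hub}   _ = after-hub
  after-red {spoke} _ = after-spoke

Tiling : List Letter → Set
Tiling ls = ∃[ cs ] Tile ls cs

tile⇒cyclic : ∀ {ls cs} → Tile ls cs → T (cyclic ls cs)
tile⇒cyclic {cs = blue ∷ cs} t = Tile.admits-red t (Tile.ends-red t)

_⁀_ : ∀ {ls₁ ls₂} → Tiling ls₁ → Tiling ls₂ → Tiling (ls₁ ++ ls₂)
_⁀_ {ls₁} {ls₂} (cs₁@(_ ∷ _) , t₁) (cs₂@(blue ∷ _) , t₂) = cs₁ ++ cs₂ , record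
  { starts-blue = Tile.starts-blue t₁
  ; ends-red    = subst (T ∘ isRed) (sym (lastOr-++ blue cs₁ cs₂)) (Tile.ends-red t₂)
  ; admits-red  = λ red → admits-join ls₁ cs₁ (Tile.admits-red t₁ red) (Tile.admits-red t₂ (Tile.ends-red t₁))
  }

letters : List Letter
letters = X ∷ Y ∷ Z ∷ []

∈-letters : ∀ l → l ∈ letters
∈-letters X = here refl
∈-letters Y = there (here refl)
∈-letters Z = there (there (here refl))

block : ∀ cs (side : List Letter → Bool) →
        T (all (λ ls → not (side ls) ∨ tile? ls cs) (tuples letters (length cs))) →
        ∀ {ls} → length ls ≡ length cs → T (side ls) → Tiling ls
block cs side check {ls} len ok = cs , tile?-sound ls cs (implies (All.lookup (all⁺ _ _ check)
  (subst (λ n → ls ∈ tuples letters n) len (∈-tuples ls (All.tabulate (λ {l} _ → ∈-letters l))))) ok)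

isX isY isZ : Letter → Bool
isX X = true
isX _ = false
isY Y = true
isY _ = false
isZ Z = true
isZ _ = false

NoX : List Letter → Set
NoX = All (T ∘ not ∘ isX)

-- Blocks are named by their roles: B blue, H hub, S spoke.
BH : ∀ {a b} → T (not (isZ b)) → Tiling (a ∷ b ∷ [])
BH {a} {b} = block (blue ∷ hub ∷ []) side tt {a ∷ b ∷ []} refl
  where
  side : List Letter → Bool
  side (_ ∷ b ∷ []) = not (isZ b)
  side _            = false

BHS : ∀ {a b c} → T (not (isY c)) → Tiling (a ∷ b ∷ c ∷ [])
BHS {a} {b} {c} = block (blue ∷ hub ∷ spoke ∷ []) side tt {a ∷ b ∷ c ∷ []} refl
  where
  side : List Letter → Bool
  side (_ ∷ _ ∷ c ∷ []) = not (isY c)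
  side _                = false

BSH : ∀ {a b c} → T (not (isY b)) → Tiling (a ∷ b ∷ c ∷ [])
BSH {a} {b} {c} = block (blue ∷ spoke ∷ hub ∷ []) side tt {a ∷ b ∷ c ∷ []} refl
  where
  side : List Letter → Bool
  side (_ ∷ b ∷ _ ∷ []) = not (isY b)
  side _                = false

BSHS : ∀ {a b c d} → T (not (isY b) ∧ not (isY d)) → Tiling (a ∷ b ∷ c ∷ d ∷ [])
BSHS {a} {b} {c} {d} = block (blue ∷ spoke ∷ hub ∷ spoke ∷ []) side tt {a ∷ b ∷ c ∷ d ∷ []} refl
  where
  side : List Letter → Bool
  side (_ ∷ b ∷ _ ∷ d ∷ []) = not (isY b) ∧ not (isY d)
  side _                    = false

BBH : ∀ {a b c} → T (not (isZ c) ∧ (not (isX b) ∧ not (isX a))) → Tiling (a ∷ b ∷ c ∷ [])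
BBH {a} {b} {c} = block (blue ∷ blue ∷ hub ∷ []) side tt {a ∷ b ∷ c ∷ []} refl
  where
  side : List Letter → Bool
  side (a ∷ b ∷ c ∷ []) = not (isZ c) ∧ (not (isX b) ∧ not (isX a))
  side _                = false

BBSH : ∀ {a b c d} → T (not (isY c) ∧ (not (isX b) ∧ not (isX a))) → Tiling (a ∷ b ∷ c ∷ d ∷ [])
BBSH {a} {b} {c} {d} = block (blue ∷ blue ∷ spoke ∷ hub ∷ []) side tt {a ∷ b ∷ c ∷ d ∷ []} refl
  where
  side : List Letter → Bool
  side (a ∷ b ∷ c ∷ _ ∷ []) = not (isY c) ∧ (not (isX b) ∧ not (isX a))
  side _                    = false

BBSHS : ∀ {a b c d e} → T (not (isY e) ∧ (not (isY c) ∧ (not (isX b) ∧ not (isX a)))) →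
        Tiling (a ∷ b ∷ c ∷ d ∷ e ∷ [])
BBSHS {a} {b} {c} {d} {e} = block (blue ∷ blue ∷ spoke ∷ hub ∷ spoke ∷ []) side tt {a ∷ b ∷ c ∷ d ∷ e ∷ []} refl
  where
  side : List Letter → Bool
  side (a ∷ b ∷ c ∷ _ ∷ e ∷ []) = not (isY e) ∧ (not (isY c) ∧ (not (isX b) ∧ not (isX a)))
  side _                        = false

tiling-X : ∀ u → 1 ≤ length u → Tiling (u ++ X ∷ [])
tiling-X (a ∷ [])              _ = BH tt
tiling-X (a ∷ b ∷ [])          _ = BHS tt
tiling-X (a ∷ X ∷ c ∷ u)       _ = BH tt ⁀ tiling-X (c ∷ u) (s≤s z≤n)
tiling-X (a ∷ Y ∷ c ∷ u)       _ = BH tt ⁀ tiling-X (c ∷ u) (s≤s z≤n)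
tiling-X (a ∷ Z ∷ c ∷ [])      _ = BSHS tt
tiling-X (a ∷ Z ∷ c ∷ d ∷ u)   _ = BSH tt ⁀ tiling-X (d ∷ u) (s≤s z≤n)

tiling-ZY : ∀ u → NoX u → Tiling (u ++ Z ∷ Y ∷ [])
tiling-ZY []                  _                 = BH tt
tiling-ZY (a ∷ [])            _                 = BSH tt
tiling-ZY (a ∷ Y ∷ u)         (_ ∷ _ ∷ noX)     = BH tt ⁀ tiling-ZY u noX
tiling-ZY (a ∷ Z ∷ [])        (a≠X ∷ _)         = BBSH a≠X
tiling-ZY (a ∷ Z ∷ c ∷ u)     (_ ∷ _ ∷ _ ∷ noX) = BSH tt ⁀ tiling-ZY u noX

tiling-Y : ∀ n → 2 ≤ n → Tiling (replicate n Y)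
tiling-Y 0                         ()
tiling-Y 1                         (s≤s ())
tiling-Y 2                         _ = BH tt
tiling-Y 3                         _ = BBH tt
tiling-Y (suc (suc (suc (suc n))))  _ = BH tt ⁀ tiling-Y (suc (suc n)) (s≤s (s≤s z≤n))

tiling-Z : ∀ n → 3 ≤ n → Tiling (replicate n Z)
tiling-Z 0 ()
tiling-Z 1 (s≤s ())
tiling-Z 2 (s≤s (s≤s ()))
tiling-Z 3 _ = BSH tt
tiling-Z 4 _ = BBSH tt
tiling-Z 5 _ = BBSHS tt
tiling-Z (suc (suc (suc (suc (suc (suc n)))))) _ = BSH tt ⁀ tiling-Z (suc (suc (suc n))) (s≤s (s≤s (s≤s z≤n)))

tiling⇒colourable : ∀ {ls} → Tiling ls → Colourable ls
tiling⇒colourable (cs , t) = cs , tile⇒cyclic t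

X-split : ∀ ls → (∃[ u ] ∃[ v ] ls ≡ u ++ X ∷ v) ⊎ NoX ls
X-split []       = inj₂ []
X-split (X ∷ ls) = inj₁ ([] , ls , refl)
X-split (Y ∷ ls) with X-split ls
... | inj₁ (u , v , refl) = inj₁ (Y ∷ u , v , refl)
... | inj₂ noX            = inj₂ (tt ∷ noX)
X-split (Z ∷ ls) with X-split ls
... | inj₁ (u , v , refl) = inj₁ (Z ∷ u , v , refl)
... | inj₂ noX            = inj₂ (tt ∷ noX)

ZY-or-sorted : ∀ ls → NoX ls →
               (∃[ u ] ∃[ v ] ls ≡ u ++ Z ∷ Y ∷ v) ⊎ (∃[ a ] ∃[ b ] ls ≡ replicate a Y ++ replicate b Z)
ZY-or-sorted []       _           = inj₂ (0 , 0 , refl)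
ZY-or-sorted (Y ∷ ls) (_ ∷ noX) with ZY-or-sorted ls noX
... | inj₁ (u , v , refl) = inj₁ (Y ∷ u , v , refl)
... | inj₂ (a , b , refl) = inj₂ (suc a , b , refl)
ZY-or-sorted (Z ∷ ls) (_ ∷ noX) with ZY-or-sorted ls noX
... | inj₁ (u , v , refl)       = inj₁ (Z ∷ u , v , refl)
... | inj₂ (zero , b , refl)    = inj₂ (0 , suc b , refl)
... | inj₂ (suc a , b , refl)   = inj₁ ([] , replicate a Y ++ replicate b Z , refl)

length-rotate : ∀ {A : Set} (u : List A) x v → length (u ++ x ∷ v) ≡ suc (length (v ++ u))
length-rotate u x v = trans (length-++-sucʳ u x v) (cong suc (length-++-comm u v))

replicate-ZY : ∀ b → replicate (suc b) Z ++ Y ∷ [] ≡ replicate b Z ++ Z ∷ Y ∷ []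
replicate-ZY zero    = refl
replicate-ZY (suc b) = cong (Z ∷_) (replicate-ZY b)

colourable : ∀ ls → 3 ≤ length ls → Colourable ls
colourable ls 3≤ with X-split ls
... | inj₁ (u , v , refl) =
  subst Colourable (++-assoc u (X ∷ []) v)
    (rotate (u ++ X ∷ []) v (subst Colourable (++-assoc v u (X ∷ []))
      (tiling⇒colourable (tiling-X (v ++ u)
        (≤-trans (s≤s z≤n) (≤-pred (subst (3 ≤_) (length-rotate u X v) 3≤)))))))
... | inj₂ noX with ZY-or-sorted ls noX
...   | inj₁ (u , v , refl) with Allₚ.++⁻ u noX
...     | noX-u , (_ ∷ _ ∷ noX-v) =
  subst Colourable (++-assoc u (Z ∷ Y ∷ []) v)
    (rotate (u ++ Z ∷ Y ∷ []) v (subst Colourable (++-assoc v u (Z ∷ Y ∷ []))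
      (tiling⇒colourable (tiling-ZY (v ++ u) (Allₚ.++⁺ noX-v noX-u)))))
colourable _ 3≤ | inj₂ _ | inj₂ (zero , b , refl) =
  tiling⇒colourable (tiling-Z b (subst (3 ≤_) (length-replicate b) 3≤))
colourable _ 3≤ | inj₂ _ | inj₂ (suc a , zero , refl) =
  subst Colourable (sym (++-identityʳ (replicate (suc a) Y)))
    (tiling⇒colourable (tiling-Y (suc a) (≤-trans (n≤1+n 2)
      (subst (3 ≤_) (trans (cong length (++-identityʳ (replicate (suc a) Y))) (length-replicate (suc a))) 3≤))))
colourable _ _ | inj₂ _ | inj₂ (suc a , suc b , refl) =
  rotate (Y ∷ []) (replicate a Y ++ replicate (suc b) Z) (subst Colourable sorted-rotated
    (tiling⇒colourable (tiling-ZY (replicate a Y ++ replicate b Z)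
      (Allₚ.++⁺ (Allₚ.replicate⁺ a tt) (Allₚ.replicate⁺ b tt)))))
  where
  sorted-rotated : (replicate a Y ++ replicate b Z) ++ Z ∷ Y ∷ [] ≡ (replicate a Y ++ replicate (suc b) Z) ++ Y ∷ []
  sorted-rotated = begin
    (replicate a Y ++ replicate b Z) ++ Z ∷ Y ∷ [] ≡⟨ ++-assoc (replicate a Y) _ _ ⟩
    replicate a Y ++ (replicate b Z ++ Z ∷ Y ∷ []) ≡⟨ cong (replicate a Y ++_) (replicate-ZY b) ⟨
    replicate a Y ++ (replicate (suc b) Z ++ Y ∷ []) ≡⟨ ++-assoc (replicate a Y) _ _ ⟨
    (replicate a Y ++ replicate (suc b) Z) ++ Y ∷ [] ∎
    where open ≡-Reasoning

nth : {A : Set} → A → List A → ℕ → A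
nth d []       _       = d
nth d (x ∷ xs) zero    = x
nth d (x ∷ xs) (suc n) = nth d xs n

admits-nth : ∀ {n} (w : Fin n → Letter) {p q} cs → T (admits p (tabulate w) cs q) → ∀ i →
             T (admissible (w i) (nth blue (p ∷ cs) (toℕ i)) (nth blue cs (toℕ i))
                                 (nth blue (cs ++ q ∷ []) (suc (toℕ i))))
admits-nth w {p} {q} (c ∷ cs) h Fin.zero with to (T-∧ {admissible (w Fin.zero) p c (headOr q cs)}) h
... | step , _ = subst (T ∘ admissible (w Fin.zero) p c) (headOr≡nth cs) step
  where
  headOr≡nth : ∀ cs → headOr q cs ≡ nth blue (cs ++ q ∷ []) 0
  headOr≡nth []      = refl
  headOr≡nth (_ ∷ _) = refl
admits-nth w {p} {q} (c ∷ cs) h (Fin.suc i) =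
  admits-nth (w ∘ Fin.suc) cs (proj₂ (to (T-∧ {admissible (w Fin.zero) p c (headOr q cs)}) h)) i

lastOr≡nth : ∀ {d e : Role} cs {n} → length cs ≡ suc n → lastOr d cs ≡ nth e cs n
lastOr≡nth (c ∷ [])              {zero}  _  = refl
lastOr≡nth {e = e} (c ∷ c′ ∷ cs) {suc n} eq = lastOr≡nth {c} {e} (c′ ∷ cs) (suc-injective eq)

nth-++ˡ : ∀ {A : Set} {d : A} cs {ys t} → t < length cs → nth d (cs ++ ys) t ≡ nth d cs t
nth-++ˡ (c ∷ cs) {t = zero}  _         = refl
nth-++ˡ (c ∷ cs) {t = suc t} (s≤s t<) = nth-++ˡ cs t<

nth-++-length : ∀ {A : Set} {d : A} cs {y} → nth d (cs ++ y ∷ []) (length cs) ≡ y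
nth-++-length []       = refl
nth-++-length (c ∷ cs) = nth-++-length cs

module CycleOrder (m : ℕ) where

  next : Fin (suc m) → Fin (suc m)
  next a = Fin.fromℕ< (m%n<n (suc (toℕ a)) (suc m))

  prev : Fin (suc m) → Fin (suc m)
  prev Fin.zero    = Fin.fromℕ m
  prev (Fin.suc i) = Fin.inject₁ i

  toℕ-next : ∀ a → toℕ (next a) ≡ suc (toℕ a) % suc m
  toℕ-next a = toℕ-fromℕ< (m%n<n (suc (toℕ a)) (suc m))

  toℕ-prev : ∀ a → toℕ a ≡ suc (toℕ (prev a)) % suc m
  toℕ-prev Fin.zero    = sym (trans (cong (λ n → suc n % suc m) (toℕ-fromℕ m)) (n%n≡0 (suc m)))
  toℕ-prev (Fin.suc i) = sym (trans (cong (λ n → suc n % suc m) (toℕ-inject₁ i)) (m<n⇒m%n≡m (s≤s (toℕ<n i))))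

  cycle-neighbour : ∀ {a b} → CycAdj (suc m) a b → b ≡ next a ⊎ b ≡ prev a
  cycle-neighbour {a} (inj₁ e) = inj₁ (toℕ-injective (trans e (sym (toℕ-next a))))
  cycle-neighbour {a} {b} (inj₂ e) with m≤n⇒m<n∨m≡n (≤-pred (toℕ<n b))
  cycle-neighbour {Fin.zero}  {b} (inj₂ e) | inj₁ b<m with () ← trans e (m<n⇒m%n≡m (s≤s b<m))
  cycle-neighbour {Fin.zero}  {b} (inj₂ e) | inj₂ b≡m = inj₂ (toℕ-injective (trans b≡m (sym (toℕ-fromℕ m))))
  cycle-neighbour {Fin.suc i} {b} (inj₂ e) | inj₁ b<m =
    inj₂ (toℕ-injective (trans (suc-injective (sym (trans e (m<n⇒m%n≡m (s≤s b<m))))) (sym (toℕ-inject₁ i))))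
  cycle-neighbour {Fin.suc i} {b} (inj₂ e) | inj₂ b≡m
    with () ← trans e (trans (cong (λ n → suc n % suc m) b≡m) (n%n≡0 (suc m)))

  cycle-colouring : 2 ≤ m → (w : Fin (suc m) → Letter) →
                    Σ[ col ∈ (Fin (suc m) → Role) ]
                      (∀ a → T (admissible (w a) (col (prev a)) (col a) (col (next a))))
  cycle-colouring 2≤m w with colourable (tabulate w) (subst (3 ≤_) (sym (length-tabulate w)) (s≤s 2≤m))
  ... | cs , h = col , λ a → subst₂ (λ l r → T (admissible (w a) l (col a) r)) (left a) (right a)
                               (admits-nth w cs h a)
    where
    length-cs : length cs ≡ suc m
    length-cs = trans (sym (admits-length (tabulate w) cs h)) (length-tabulate w)
    col : Fin (suc m) → Role
    col a = nth blue cs (toℕ a)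
    left : ∀ a → nth blue (lastOr blue cs ∷ cs) (toℕ a) ≡ col (prev a)
    left Fin.zero    = trans (lastOr≡nth {blue} {blue} cs length-cs) (cong (nth blue cs) (sym (toℕ-fromℕ m)))
    left (Fin.suc i) = cong (nth blue cs) (sym (toℕ-inject₁ i))
    right : ∀ a → nth blue (cs ++ headOr blue cs ∷ []) (suc (toℕ a)) ≡ col (next a)
    right a with m≤n⇒m<n∨m≡n (≤-pred (toℕ<n a))
    ... | inj₁ a<m = trans (nth-++ˡ {d = blue} cs {headOr blue cs ∷ []}
                              (subst (suc (toℕ a) <_) (sym length-cs) (s≤s a<m)))
                       (cong (nth blue cs) (sym (trans (toℕ-next a) (m<n⇒m%n≡m (s≤s a<m)))))
    ... | inj₂ a≡m = trans (subst (λ n → nth blue (cs ++ headOr blue cs ∷ []) n ≡ headOr blue cs)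
                                  (trans length-cs (cong suc (sym a≡m))) (nth-++-length {d = blue} cs))
                       (sym (trans (cong (nth blue cs)
                                     (trans (toℕ-next a) (trans (cong (λ n → suc n % suc m) a≡m) (n%n≡0 (suc m)))))
                                   (head≡nth cs)))
      where
      head≡nth : ∀ cs → nth blue cs 0 ≡ headOr blue cs
      head≡nth []      = refl
      head≡nth (_ ∷ _) = refl

-- Rooted trees

module _ (Γ : FinGraph) where

  open FinGraph Γ

  closed-walk⇒cycle : ∀ M → 2 ≤ M → (g : ℕ → Fin size) →
                      (∀ {s t} → s ≤ M → t ≤ M → g s ≡ g t → s ≡ t) →
                      (∀ {t} → t < M → adj (g t) (g (suc t)) ≡ true) →
                      adj (g M) (g 0) ≡ true → HasCycle
  closed-walk⇒cycle M 2≤M g g-inj g-edge g-close = suc M , s≤s 2≤M , f , f-inj , f-edge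
    where
    f : Fin (suc M) → Fin size
    f a = g (toℕ a)

    bounded : ∀ (a : Fin (suc M)) → toℕ a ≤ M
    bounded a = ≤-pred (toℕ<n a)

    f-inj : ∀ {a b} → f a ≡ f b → a ≡ b
    f-inj {a} {b} e = toℕ-injective (g-inj (bounded a) (bounded b) e)

    successor-edge : ∀ {s t} → s ≤ M → t ≡ suc s % suc M → adj (g s) (g t) ≡ true
    successor-edge {s} s≤M refl with m≤n⇒m<n∨m≡n s≤M
    ... | inj₁ s<M  = subst (λ t → adj (g s) (g t) ≡ true) (sym (m<n⇒m%n≡m (s≤s s<M))) (g-edge s<M)
    ... | inj₂ refl = subst (λ t → adj (g M) (g t) ≡ true) (sym (n%n≡0 (suc M))) g-close

    f-edge : ∀ a b → CycAdj (suc M) a b → adj (f a) (f b) ≡ true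
    f-edge a b (inj₁ e) = successor-edge (bounded a) e
    f-edge a b (inj₂ e) = trans (symm (f a) (f b)) (successor-edge (bounded b) e)

module Rooting (Γ : FinGraph) (r : Fin (FinGraph.size Γ)) (connected : FinGraph.Connected Γ) where

  open FinGraph Γ

  Vertex : Set
  Vertex = Fin size

  Edge : Vertex → Vertex → Set
  Edge x y = adj x y ≡ true

  edge-sym : ∀ {x y} → Edge x y → Edge y x
  edge-sym {x} {y} e = trans (symm y x) e

  _==_ : Vertex → Vertex → Bool
  a == b = isYes (a ≟ b)

  walk-length : ∀ {x y} → Walk x y → ℕ
  walk-length here       = 0
  walk-length (step _ w) = suc (walk-length w)

  Near : ℕ → Vertex → Bool
  Near zero    x = x == r
  Near (suc n) x = Near n x ∨ any (λ y → adj x y ∧ Near n y) (allFin size)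

  Near-step : ∀ {n x y} → Edge x y → T (Near n y) → T (Near (suc n) x)
  Near-step {n} {x} {y} e near = from T-∨ (inj₂ (any⁺ _ (lose (∈-allFin y) (from T-∧ (from T-≡ e , near)))))

  Near-walk : ∀ {x} (w : Walk x r) → T (Near (walk-length w) x)
  Near-walk here       = fromWitness refl
  Near-walk (step e w) = Near-step {walk-length w} e (Near-walk w)

  depth : Vertex → ℕ
  depth x = least (λ n → Near n x) (walk-length (connected x r))

  Near-depth : ∀ x → T (Near (depth x) x)
  Near-depth x = least-satisfies (λ n → Near n x) (walk-length (connected x r)) ≤-refl (Near-walk (connected x r))

  depth-least : ∀ {n x} → T (Near n x) → depth x ≤ n
  depth-least {x = x} = least-≤ (λ n → Near n x) (walk-length (connected x r))

  depth-root : depth r ≡ 0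
  depth-root = n≤0⇒n≡0 (depth-least {0} (fromWitness refl))

  depth≡0⇒root : ∀ {x} → depth x ≡ 0 → x ≡ r
  depth≡0⇒root {x} d with x ≟ r | subst (λ n → T (Near n x)) d (Near-depth x)
  ... | yes x≡r | _ = x≡r

  depth-edge : ∀ {x y} → Edge x y → depth y ≤ suc (depth x)
  depth-edge {x} e = depth-least (Near-step {depth x} (edge-sym e) (Near-depth x))

  -- At the root, parent is a junk value.
  parent : Vertex → Vertex
  parent x = first x (λ y → adj x y ∧ Near (pred (depth x)) y) (allFin size)

  private
    parent-spec : ∀ {x} → x ≢ r → T (adj x (parent x) ∧ Near (pred (depth x)) (parent x))
    parent-spec {x} x≢r = first-satisfies (λ y → adj x y ∧ Near (pred (depth x)) y) (allFin size) (closer x≢r)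
      where
      closer : ∀ {x} → x ≢ r → T (any (λ y → adj x y ∧ Near (pred (depth x)) y) (allFin size))
      closer {x} x≢r with depth x in d | Near-depth x
      ... | zero  | _    = ⊥-elim (x≢r (depth≡0⇒root d))
      ... | suc n | near with to T-∨ near
      ...   | inj₁ near-n = ⊥-elim (1+n≰n (subst (_≤ n) d (depth-least near-n)))
      ...   | inj₂ some   = some

  parent-edge : ∀ {x} → x ≢ r → Edge x (parent x)
  parent-edge x≢r = to T-≡ (proj₁ (to T-∧ (parent-spec x≢r)))

  depth-parent : ∀ {x} → x ≢ r → depth x ≡ suc (depth (parent x))
  depth-parent {x} x≢r =
    squeeze (depth x) (x≢r ∘ depth≡0⇒root) (depth-edge (edge-sym (parent-edge x≢r)))
      (depth-least (proj₂ (to T-∧ (parent-spec x≢r))))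
    where
    squeeze : ∀ d {e} → d ≢ 0 → d ≤ suc e → e ≤ pred d → d ≡ suc e
    squeeze zero    d≢0 _   _   = ⊥-elim (d≢0 refl)
    squeeze (suc n) _   d≤e e≤n = cong suc (≤-antisym (≤-pred d≤e) e≤n)

  ancestor : ℕ → Vertex → Vertex
  ancestor zero    x = x
  ancestor (suc n) x = parent (ancestor n x)

  0<depth⇒≢root : ∀ {x} → 0 < depth x → x ≢ r
  0<depth⇒≢root {x} pos refl = 1+n≰n (subst (0 <_) depth-root pos)

  depth-ancestor : ∀ {n x} → n ≤ depth x → depth (ancestor n x) + n ≡ depth x
  depth-ancestor {zero}  {x} _   = +-identityʳ (depth x)
  depth-ancestor {suc n} {x} n<d = begin
    depth (parent a) + suc n   ≡⟨ +-suc (depth (parent a)) n ⟩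
    suc (depth (parent a)) + n ≡⟨ cong (_+ n) (sym (depth-parent a≢r)) ⟩
    depth a + n                ≡⟨ ih ⟩
    depth x                    ∎
    where
    open ≡-Reasoning
    a = ancestor n x
    ih : depth a + n ≡ depth x
    ih = depth-ancestor (≤-trans (n≤1+n n) n<d)
    a≢r : a ≢ r
    a≢r = 0<depth⇒≢root (+-cancelʳ-< n 0 (depth a) (subst (n <_) (sym ih) n<d))

  ancestor-≢root : ∀ {n x} → n < depth x → ancestor n x ≢ r
  ancestor-≢root {n} {x} n<d =
    0<depth⇒≢root (+-cancelʳ-< n 0 _ (subst (n <_) (sym (depth-ancestor {n} (<⇒≤ n<d))) n<d))

  ancestor-depth : ∀ x → ancestor (depth x) x ≡ r
  ancestor-depth x = depth≡0⇒root (+-cancelʳ-≡ (depth x) _ 0 (depth-ancestor ≤-refl))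

  ancestor-injective : ∀ {m n x} → m ≤ depth x → n ≤ depth x → ancestor m x ≡ ancestor n x → m ≡ n
  ancestor-injective {m} {n} {x} m≤d n≤d e = +-cancelˡ-≡ (depth (ancestor m x)) m n
    (trans (depth-ancestor m≤d) (sym (trans (cong (λ a → depth a + n) e) (depth-ancestor n≤d))))

  ancestor-edge : ∀ {n x} → n < depth x → Edge (ancestor n x) (ancestor (suc n) x)
  ancestor-edge n<d = parent-edge (ancestor-≢root n<d)

  -- The first ancestor of x that is also an ancestor of y.
  module Meeting (x y : Vertex) where

    partner : ℕ → ℕ
    partner i = least (λ j → ancestor i x == ancestor j y) (depth y)

    shared : ℕ → Bool
    shared i = ancestor i x == ancestor (partner i) y

    shared-intro : ∀ {i j} → j ≤ depth y → ancestor i x ≡ ancestor j y → T (shared i)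
    shared-intro {i} j≤d e = least-satisfies (λ j → ancestor i x == ancestor j y) (depth y) j≤d (fromWitness e)

    i j : ℕ
    i = least shared (depth x)
    j = partner i

    i≤depth : i ≤ depth x
    i≤depth = least-bounded shared (depth x)

    j≤depth : j ≤ depth y
    j≤depth = least-bounded (λ j → ancestor i x == ancestor j y) (depth y)

    meet : ancestor i x ≡ ancestor j y
    meet = toWitness (least-satisfies shared (depth x) ≤-refl
             (shared-intro {depth x} ≤-refl (trans (ancestor-depth x) (sym (ancestor-depth y)))))

    before-meet : ∀ {s t} → s < i → t ≤ depth y → ancestor s x ≢ ancestor t y
    before-meet {s} s<i t≤d e = 1+n≰n (≤-trans s<i (least-≤ shared (depth x) (shared-intro {s} t≤d e)))

  -- An edge joining neither vertex to its parent closes a cycle: up from x to the meeting vertex,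
  -- down to y, and back along the edge.
  module NonParentalEdge {x y : Vertex} (xy : Edge x y)
                         (¬xy : ¬ (x ≢ r × parent x ≡ y)) (¬yx : ¬ (y ≢ r × parent y ≡ x)) where

    open Meeting x y

    M : ℕ
    M = i + j

    tour : ℕ → Vertex
    tour t with t ≤? i
    ... | yes _ = ancestor t x
    ... | no _  = ancestor (M ∸ t) y

    tour-up : ∀ {t} → t ≤ i → tour t ≡ ancestor t x
    tour-up {t} t≤i with t ≤? i
    ... | yes _  = refl
    ... | no t≰i = ⊥-elim (t≰i t≤i)

    tour-down : ∀ {t} → i ≤ t → tour t ≡ ancestor (M ∸ t) y
    tour-down {t} i≤t with t ≤? i
    ... | no _ = refl
    ... | yes t≤i with ≤-antisym t≤i i≤t
    ...   | refl = trans meet (cong (λ n → ancestor n y) (sym (m+n∸m≡n i j)))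

    down-index≤ : ∀ {t} → i ≤ t → M ∸ t ≤ j
    down-index≤ {t} i≤t = subst (M ∸ t ≤_) (m+n∸m≡n i j) (∸-monoʳ-≤ M i≤t)

    down-index< : ∀ {t} → i < t → t ≤ M → M ∸ t < j
    down-index< {t} i<t t≤M = subst (M ∸ t <_) (m+n∸m≡n i j) (∸-monoʳ-< i<t t≤M)

    down-index≤depth : ∀ {t} → i < t → t ≤ M → M ∸ t ≤ depth y
    down-index≤depth i<t t≤M = ≤-trans (<⇒≤ (down-index< i<t t≤M)) j≤depth

    at-least-two : 2 ≤ M
    at-least-two = helper i j meet i≤depth j≤depth
      where
      helper : ∀ m n → ancestor m x ≡ ancestor n y → m ≤ depth x → n ≤ depth y → 2 ≤ m + n
      helper 0             0             x≡y _   _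
        with () ← trans (sym (irrfl x)) (subst (λ z → adj x z ≡ true) (sym x≡y) xy)
      helper 0             1             e   _   1≤d = ⊥-elim (¬yx (0<depth⇒≢root 1≤d , sym e))
      helper 1             0             e   1≤d _   = ⊥-elim (¬xy (0<depth⇒≢root 1≤d , e))
      helper 0             (suc (suc _)) _   _   _   = s≤s (s≤s z≤n)
      helper 1             (suc _)       _   _   _   = s≤s (s≤s z≤n)
      helper (suc (suc _)) _             _   _   _   = s≤s (s≤s z≤n)

    crossing : ∀ {s t} → s ≤ i → i < t → t ≤ M → ancestor s x ≢ ancestor (M ∸ t) y
    crossing s≤i i<t t≤M e with m≤n⇒m<n∨m≡n s≤i
    ... | inj₁ s<i  = before-meet s<i (down-index≤depth i<t t≤M) e
    ... | inj₂ refl = <-irrefl (ancestor-injective (down-index≤depth i<t t≤M) j≤depth (trans (sym e) meet))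
                        (down-index< i<t t≤M)

    tour-injective : ∀ {s t} → s ≤ M → t ≤ M → tour s ≡ tour t → s ≡ t
    tour-injective {s} {t} s≤M t≤M e with ≤-<-connex s i | ≤-<-connex t i
    ... | inj₁ s≤i | inj₁ t≤i = ancestor-injective (≤-trans s≤i i≤depth) (≤-trans t≤i i≤depth)
                                  (trans (sym (tour-up s≤i)) (trans e (tour-up t≤i)))
    ... | inj₁ s≤i | inj₂ i<t =
      ⊥-elim (crossing s≤i i<t t≤M (trans (sym (tour-up s≤i)) (trans e (tour-down (<⇒≤ i<t)))))
    ... | inj₂ i<s | inj₁ t≤i =
      ⊥-elim (crossing t≤i i<s s≤M (trans (sym (tour-up t≤i)) (trans (sym e) (tour-down (<⇒≤ i<s)))))
    ... | inj₂ i<s | inj₂ i<t =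
      ∸-cancelˡ-≡ s≤M t≤M (ancestor-injective (down-index≤depth i<s s≤M) (down-index≤depth i<t t≤M)
                            (trans (sym (tour-down (<⇒≤ i<s))) (trans e (tour-down (<⇒≤ i<t)))))

    tour-edge : ∀ {t} → t < M → Edge (tour t) (tour (suc t))
    tour-edge {t} t<M with <-≤-connex t i
    ... | inj₁ t<i = subst₂ Edge (sym (tour-up (<⇒≤ t<i))) (sym (tour-up t<i))
                       (ancestor-edge (<-≤-trans t<i i≤depth))
    ... | inj₂ i≤t = subst₂ Edge (sym (trans (tour-down i≤t) (cong (λ n → ancestor n y) M∸t≡1+e)))
                       (sym (tour-down (≤-trans i≤t (n≤1+n t))))
                       (edge-sym (ancestor-edge (<-≤-trans (subst (_≤ j) M∸t≡1+e (down-index≤ i≤t)) j≤depth)))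
      where
      M∸t≡1+e : M ∸ t ≡ suc (M ∸ suc t)
      M∸t≡1+e = ∸-suc M t<M

    tour-closes : Edge (tour M) (tour 0)
    tour-closes = subst₂ Edge (sym (trans (tour-down (m≤m+n i j)) (cong (λ n → ancestor n y) (n∸n≡0 M))))
                (sym (tour-up z≤n)) (edge-sym xy)

    cycle : HasCycle
    cycle = closed-walk⇒cycle Γ M at-least-two tour tour-injective tour-edge tour-closes

  edge⇒parental : ¬ HasCycle → ∀ {x y} → Edge x y → (x ≢ r × parent x ≡ y) ⊎ (y ≢ r × parent y ≡ x)
  edge⇒parental acyclic {x} {y} xy with parental? x y | parental? y x
    where
    parental? : ∀ a b → Dec (a ≢ r × parent a ≡ b)
    parental? a b = ¬? (a ≟ r) ×-dec (parent a ≟ b)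
  ... | yes p | _     = inj₁ p
  ... | no _  | yes q = inj₂ q
  ... | no ¬p | no ¬q = ⊥-elim (acyclic (NonParentalEdge.cycle xy ¬p ¬q))

  isChild : Vertex → Vertex → Bool
  isChild x y = not (y == r) ∧ (parent y == x)

  children : Vertex → List Vertex
  children x = filterᵇ (isChild x) (allFin size)

  ∈-children⁺ : ∀ {x y} → y ≢ r → parent y ≡ x → y ∈ children x
  ∈-children⁺ {x} {y} y≢r py≡x =
    ∈-filter⁺ (T? ∘ isChild x) (∈-allFin y)
      (from T-∧ (fromWitnessFalse {a? = y ≟ r} y≢r , fromWitness {a? = parent y ≟ x} py≡x))

  ∈-children⁻ : ∀ {x y} → y ∈ children x → y ≢ r × parent y ≡ x
  ∈-children⁻ {x} {y} y∈
    with to (T-∧ {not (y == r)}) (proj₂ (∈-filter⁻ (T? ∘ isChild x) {xs = allFin size} y∈))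
  ... | y≠r , py≡x = toWitnessFalse {a? = y ≟ r} y≠r , toWitness {a? = parent y ≟ x} py≡x

  children-unique : ∀ x → Unique (children x)
  children-unique x = Uniqueₚ.filter⁺ (T? ∘ isChild x) (Uniqueₚ.allFin⁺ size)

  child-edge : ∀ {x y} → y ∈ children x → Edge x y
  child-edge y∈ with ∈-children⁻ y∈
  ... | y≢r , refl = edge-sym (parent-edge y≢r)

  child-depth : ∀ {x y} → y ∈ children x → depth y ≡ suc (depth x)
  child-depth y∈ with ∈-children⁻ y∈
  ... | y≢r , refl = depth-parent y≢r

  parent-not-child : ∀ {x} → x ≢ r → parent x ∈ children x → ⊥
  parent-not-child {x} x≢r px∈ = 1+n≰n (≤-trans (n≤1+n _) (≤-reflexive (sym loop)))
    where
    loop : depth x ≡ suc (suc (depth x))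
    loop = trans (depth-parent x≢r) (cong suc (child-depth px∈))

  degree≡count : ∀ x → degree x ≡ count (adj x) (allFin size)
  degree≡count x = sum-indicator (allFin size)

  children-bound : ∀ x → x ≢ r → suc (length (children x)) ≤ degree x
  children-bound x x≢r = begin
    1 + count (isChild x) (allFin size)
      ≤⟨ +-monoˡ-≤ _ (count-pos (∈-allFin (parent x)) (fromWitness refl)) ⟩
    count (_== parent x) (allFin size) + count (isChild x) (allFin size)
      ≡⟨ count-∨ (allFin size) disjoint ⟨
    count (λ y → (y == parent x) ∨ isChild x y) (allFin size)
      ≤⟨ count-mono (allFin size) neighbour ⟩
    count (adj x) (allFin size)
      ≡⟨ degree≡count x ⟨
    degree x ∎
    where
    open ≤-Reasoning
    child : ∀ {y} → T (isChild x y) → y ∈ children x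
    child = ∈-filter⁺ (T? ∘ isChild x) (∈-allFin _)
    disjoint : ∀ {y} → T (y == parent x) → T (isChild x y) → ⊥
    disjoint y=p c = parent-not-child x≢r (subst (_∈ children x) (toWitness y=p) (child c))
    neighbour : ∀ {y} → T ((y == parent x) ∨ isChild x y) → T (adj x y)
    neighbour {y} h with to T-∨ h
    ... | inj₁ y=p = from T-≡ (subst (Edge x) (sym (toWitness y=p)) (parent-edge x≢r))
    ... | inj₂ c   = from T-≡ (child-edge (child c))

  root-children-bound : length (children r) ≤ degree r
  root-children-bound = subst (length (children r) ≤_) (sym (degree≡count r))
    (count-mono (allFin size) (λ c → from T-≡ (child-edge (∈-filter⁺ (T? ∘ isChild r) (∈-allFin _) c))))

-- Hands out roles to a list of distinct vertices, in order (blue is a junk value).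
assign : ∀ {n} → List (Fin n) → List Role → Fin n → Role
assign (y ∷ ys) (c ∷ cs) z = if isYes (z ≟ y) then c else assign ys cs z
assign _        _        _ = blue

module _ {n : ℕ} where

  private
    assign-here : ∀ (y : Fin n) ys c cs → assign (y ∷ ys) (c ∷ cs) y ≡ c
    assign-here y _ _ _ with y ≟ y
    ... | yes _  = refl
    ... | no y≢y = ⊥-elim (y≢y refl)

    assign-skip : ∀ {y z : Fin n} ys c cs → z ≢ y → assign (y ∷ ys) (c ∷ cs) z ≡ assign ys cs z
    assign-skip {y} {z} _ _ _ z≢y with z ≟ y
    ... | yes z≡y = ⊥-elim (z≢y z≡y)
    ... | no _    = refl

  map-assign : ∀ (ys : List (Fin n)) cs → Unique ys → length ys ≡ length cs → map (assign ys cs) ys ≡ cs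
  map-assign []       []       _              _  = refl
  map-assign (y ∷ ys) (c ∷ cs) (y∉ys ∷ uniq) eq =
    cong₂ _∷_ (assign-here y ys c cs)
      (trans (map-cong-local (All.map (λ y≢z → assign-skip ys c cs (y≢z ∘ sym)) y∉ys))
             (map-assign ys cs uniq (suc-injective eq)))

  pointwise-assign : ∀ {A : Set} {R : A → Role → Bool} (f : Fin n → A) ys cs {y} →
                     T (pointwise R (map f ys) cs) → Unique ys → y ∈ ys → T (R (f y) (assign ys cs y))
  pointwise-assign {R = R} f (y ∷ ys) (c ∷ cs) h _ (here refl) =
    subst (T ∘ R (f y)) (sym (assign-here y ys c cs)) (proj₁ (to (T-∧ {R (f y) c}) h))
  pointwise-assign {R = R} f (y ∷ ys) (c ∷ cs) {z} h (y∉ys ∷ uniq) (there z∈) =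
    subst (T ∘ R (f z)) (sym (assign-skip ys c cs (λ z≡y → All.lookup y∉ys z∈ (sym z≡y))))
      (pointwise-assign f ys cs (proj₂ (to T-∧ h)) uniq z∈)

module TreeColouring (Γ : FinGraph) (r : Fin (FinGraph.size Γ)) (connected : FinGraph.Connected Γ) where

  open FinGraph Γ
  open Rooting Γ r connected

  -- Every depth is below height, so height ∸ depth x is enough fuel to reach the leaves below x.
  height : ℕ
  height = suc (sum (map depth (allFin size)))

  depth<height : ∀ x → depth x < height
  depth<height x = s≤s (∈⇒≤sum (∈-map⁺ depth (∈-allFin x)))

  profileWithin : ℕ → Vertex → Profile
  profileWithin zero    x = combine []
  profileWithin (suc n) x = combine (map (profileWithin n) (children x))

  profile : Vertex → Profile
  profile x = profileWithin (height ∸ depth x) x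

  profile-unfold : ∀ x → profile x ≡ combine (map profile (children x))
  profile-unfold x = trans (cong (λ n → profileWithin n x) (∸-suc height (depth<height x)))
    (cong combine (map-cong-local (All.tabulate λ {y} y∈ →
      cong (λ d → profileWithin (height ∸ d) y) (sym (child-depth y∈)))))

  profile∈family : (∀ x → length (children x) ≤ 2) → ∀ x → profile x ∈ family
  profile∈family ≤2 x = within (height ∸ depth x) x
    where
    within : ∀ n x → profileWithin n x ∈ family
    within zero    x = combine-closed [] z≤n []
    within (suc n) x = combine-closed (map (profileWithin n) (children x))
      (subst (_≤ 2) (sym (length-map (profileWithin n) (children x))) (≤2 x))
      (Allₚ.map⁺ (All.tabulate (λ _ → within n _)))

  module Colouring (q₀ : Role) (rootChoice : List Role)
                   (root-fits : T (pointwise (λ π c → allowed π q₀ c) (map profile (children r)) rootChoice)) where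

    childRoles : Vertex → Role → Role → List Role
    childRoles p q v = if p == r then rootChoice else choose (map profile (children p)) q v

    descend : Vertex → Role × Role → Role × Role
    descend x (q , v) = v , assign (children (parent x)) (childRoles (parent x) q v) x

    context : ℕ → Vertex → Role × Role
    context zero    x = blue , q₀
    context (suc n) x = descend x (context n (parent x))

    role : Vertex → Role
    role x = proj₂ (context (depth x) x)

    parentRole : Vertex → Role
    parentRole x = proj₁ (context (depth x) x)

    role-root : role r ≡ q₀
    role-root = cong (λ n → proj₂ (context n r)) depth-root

    context-unfold : ∀ {x} → x ≢ r → context (depth x) x ≡ descend x (context (depth (parent x)) (parent x))
    context-unfold {x} x≢r = cong (λ n → context n x) (depth-parent x≢r)

    parentRole-≡ : ∀ {x} → x ≢ r → parentRole x ≡ role (parent x)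
    parentRole-≡ x≢r = cong proj₁ (context-unfold x≢r)

    role-child : ∀ {p y} → y ∈ children p → role y ≡ assign (children p) (childRoles p (parentRole p) (role p)) y
    role-child y∈ with ∈-children⁻ y∈
    ... | y≢r , refl = cong proj₂ (context-unfold y≢r)

    private
      childRoles-root : ∀ {q v} → childRoles r q v ≡ rootChoice
      childRoles-root with r ≟ r
      ... | yes _  = refl
      ... | no r≢r = ⊥-elim (r≢r refl)

      childRoles-nonroot : ∀ {p q v} → p ≢ r → childRoles p q v ≡ choose (map profile (children p)) q v
      childRoles-nonroot {p} p≢r with p ≟ r
      ... | yes p≡r = ⊥-elim (p≢r p≡r)
      ... | no _    = refl

    ChildrenFit : Vertex → Set
    ChildrenFit p = T (pointwise (λ π c → allowed π (role p) c) (map profile (children p))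
                                 (childRoles p (parentRole p) (role p)))

    map-role-children : ∀ p → ChildrenFit p → map role (children p) ≡ childRoles p (parentRole p) (role p)
    map-role-children p fits = trans (map-cong-local (All.tabulate role-child))
      (map-assign (children p) _ (children-unique p)
        (trans (sym (length-map profile (children p))) (pointwise-length (map profile (children p)) _ fits)))

    mutual
      consistent-below-root : ∀ n {x} → depth x ≡ n → x ≢ r →
        T (Consistent (map profile (children x)) (parentRole x) (role x) (childRoles x (parentRole x) (role x)))
      consistent-below-root n {x} d x≢r =
        subst (T ∘ Consistent (map profile (children x)) (parentRole x) (role x)) (sym (childRoles-nonroot x≢r))
          (choose-consistent (map profile (children x))
            (subst₂ (λ π q → T (allowed π q (role x))) (profile-unfold x) (sym (parentRole-≡ x≢r))
              (role-allowed n d x≢r)))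

      children-fit : ∀ n {p} → depth p ≡ n → ChildrenFit p
      children-fit n {p} d = by-cases (p ≟ r)
        where
        by-cases : Dec (p ≡ r) → ChildrenFit p
        by-cases (yes refl) = subst₂ (λ v cs → T (pointwise (λ π c → allowed π v c) (map profile (children r)) cs))
                                (sym role-root) (sym childRoles-root) root-fits
        by-cases (no p≢r)   = proj₁ (to T-∧ (consistent-below-root n d p≢r))

      role-allowed : ∀ n {x} → depth x ≡ n → x ≢ r → T (allowed (profile x) (role (parent x)) (role x))
      role-allowed zero    d x≢r = ⊥-elim (x≢r (depth≡0⇒root d))
      role-allowed (suc n) {x} d x≢r = subst (T ∘ allowed (profile x) (role (parent x))) (sym (role-child x∈))
        (pointwise-assign profile (children (parent x)) _
          (children-fit n (suc-injective (trans (sym (depth-parent x≢r)) d))) (children-unique (parent x)) x∈)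
        where
        x∈ : x ∈ children (parent x)
        x∈ = ∈-children⁺ x≢r refl

    valid-below-root : ∀ {x} → x ≢ r → T (Valid (role x) (role (parent x) ∷ map role (children x)))
    valid-below-root {x} x≢r =
      subst₂ (λ q cs → T (Valid (role x) (q ∷ cs))) (parentRole-≡ x≢r)
        (sym (map-role-children x (proj₁ (to T-∧ consistent)))) (proj₂ (to T-∧ consistent))
      where
      consistent = consistent-below-root (depth x) refl x≢r

    roles-below-root : map role (children r) ≡ rootChoice
    roles-below-root = trans (map-role-children r (children-fit (depth r) refl)) childRoles-root

module LeafRootedTree (Γ : FinGraph) (r : Fin (FinGraph.size Γ)) (tree : FinGraph.IsTree Γ)
                      (subcubic : FinGraph.Subcubic Γ) (leaf : FinGraph.IsLeaf Γ r) where

  open FinGraph Γ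
  open Rooting Γ r (proj₁ tree) public
  open TreeColouring Γ r (proj₁ tree) public

  children-≤2 : ∀ x → length (children x) ≤ 2
  children-≤2 x with x ≟ r
  ... | yes refl = ≤-trans root-children-bound (≤-trans (≤-reflexive leaf) (n≤1+n 1))
  ... | no x≢r   = ≤-pred (≤-trans (children-bound x x≢r) (subcubic x))

  private
    root-neighbour : ∃[ c ] (c ∈ allFin size × T (adj r c))
    root-neighbour = 0<count⇒witness (subst (0 <_) (degree≡count r) (≤-reflexive (sym leaf)))

  root-child : Vertex
  root-child = proj₁ root-neighbour

  root-edge : Edge r root-child
  root-edge = to T-≡ (proj₂ (proj₂ root-neighbour))

  root-neighbour∈children : ∀ {y} → Edge r y → y ∈ children r
  root-neighbour∈children e with edge⇒parental (proj₂ tree) e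
  ... | inj₁ (r≢r , _)     = ⊥-elim (r≢r refl)
  ... | inj₂ (y≢r , py≡r) = ∈-children⁺ y≢r py≡r

  children-root : children r ≡ root-child ∷ []
  children-root = single (children r) (≤-trans root-children-bound (≤-reflexive leaf))
                    (root-neighbour∈children root-edge)
    where
    single : ∀ (ys : List Vertex) {y} → length ys ≤ 1 → y ∈ ys → ys ≡ y ∷ []
    single (_ ∷ [])    _           (here refl) = refl
    single (_ ∷ _ ∷ _) (s≤s ())

  root-edge-unique : ∀ {y} → Edge r y → y ≡ root-child
  root-edge-unique e with subst (_ ∈_) children-root (root-neighbour∈children e)
  ... | here y≡c = y≡c

  neighbour-below-root : ∀ {x y} → x ≢ r → Edge x y → y ∈ parent x ∷ children x
  neighbour-below-root x≢r e with edge⇒parental (proj₂ tree) e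
  ... | inj₁ (_ , refl)     = here refl
  ... | inj₂ (y≢r , py≡x) = there (∈-children⁺ y≢r py≡x)

-- The glued graph

module Assembly (m : ℕ) (2≤m : 2 ≤ m) (I : Fin (suc m) → Bool)
  (Tr : (i : Fin (suc m)) → T (I i) → FinGraph)
  (is-tree : ∀ i p → FinGraph.IsTree (Tr i p)) (subcubic : ∀ i p → FinGraph.Subcubic (Tr i p))
  (ℓ : (i : Fin (suc m)) (p : T (I i)) → Fin (FinGraph.size (Tr i p)))
  (leaf : ∀ i p → FinGraph.IsLeaf (Tr i p) (ℓ i p)) where

  open Glue (suc m) I Tr ℓ
  open CycleOrder m
  module Pendant (i : Fin (suc m)) (p : T (I i)) =
    LeafRootedTree (Tr i p) (ℓ i p) (is-tree i p) (subcubic i p) (leaf i p)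

  pendantProfile : ∀ i (p : T (I i)) → Profile
  pendantProfile i p = Pendant.profile i p (Pendant.root-child i p)

  letterAt : ∀ i → Dec (T (I i)) → Letter
  letterAt i (yes p) = letter (pendantProfile i p)
  letterAt i (no _)  = Z

  word : Fin (suc m) → Letter
  word i = letterAt i (T? (I i))

  word-attached : ∀ {i} (p : T (I i)) → word i ≡ letter (pendantProfile i p)
  word-attached {i} p = cong (letterAt i) (dec-yes-irr (T? (I i)) T-irrelevant p)

  cycleRole : Fin (suc m) → Role
  cycleRole = proj₁ (cycle-colouring 2≤m word)

  cycle-admissible : ∀ a → T (admissible (word a) (cycleRole (prev a)) (cycleRole a) (cycleRole (next a)))
  cycle-admissible = proj₂ (cycle-colouring 2≤m word)

  pendantRole : ∀ i (p : T (I i)) → Role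
  pendantRole i p =
    first blue (Completion (pendantProfile i p) (cycleRole (prev i)) (cycleRole i) (cycleRole (next i))) roles

  pendantRole-completes : ∀ i p →
    T (Completion (pendantProfile i p) (cycleRole (prev i)) (cycleRole i) (cycleRole (next i)) (pendantRole i p))
  pendantRole-completes i p =
    first-satisfies (Completion (pendantProfile i p) (cycleRole (prev i)) (cycleRole i) (cycleRole (next i))) roles
    (supported-completion {letter (pendantProfile i p)} {pendantProfile i p}
      (letter-supports (Pendant.profile∈family i p (Pendant.children-≤2 i p) (Pendant.root-child i p)))
      (subst (λ l → T (admissible l (cycleRole (prev i)) (cycleRole i) (cycleRole (next i))))
        (word-attached p) (cycle-admissible i)))

  root-fits : ∀ i p → T (pointwise (λ π c → allowed π (cycleRole i) c)
                                   (map (Pendant.profile i p) (Pendant.children i p (ℓ i p))) (pendantRole i p ∷ []))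
  root-fits i p = subst (λ ys → T (pointwise (λ π c → allowed π (cycleRole i) c) (map (Pendant.profile i p) ys)
                                            (pendantRole i p ∷ [])))
                    (sym (Pendant.children-root i p))
                    (pointwise-singleton (λ π c → allowed π (cycleRole i) c) {pendantProfile i p} {pendantRole i p}
                      (completion-allowed (pendantProfile i p) (cycleRole (prev i)) (cycleRole i) (cycleRole (next i))
                        (pendantRole i p) (pendantRole-completes i p)))

  module Colour (i : Fin (suc m)) (p : T (I i)) =
    Pendant.Colouring i p (cycleRole i) (pendantRole i p ∷ []) (root-fits i p)

  private
    embAt : ∀ i p x → Dec (x ≡ ℓ i p) → GV
    embAt i p x (yes _)   = cyc i
    embAt i p x (no x≢ℓ) = tree i p x (fromWitnessFalse x≢ℓ)

    emb≡embAt : ∀ i p x → emb i p x ≡ embAt i p x (x ≟ ℓ i p)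
    emb≡embAt i p x with x ≟ ℓ i p
    ... | yes _ = refl
    ... | no _  = refl

  emb-root : ∀ i p → emb i p (ℓ i p) ≡ cyc i
  emb-root i p = trans (emb≡embAt i p (ℓ i p)) (at (ℓ i p ≟ ℓ i p))
    where
    at : ∀ d → embAt i p (ℓ i p) d ≡ cyc i
    at (yes _)   = refl
    at (no ℓ≢ℓ) = ⊥-elim (ℓ≢ℓ refl)

  emb-below-root : ∀ i p x (x≢ℓ : False (x ≟ ℓ i p)) → emb i p x ≡ tree i p x x≢ℓ
  emb-below-root i p x x≢ℓ = trans (emb≡embAt i p x) (at (x ≟ ℓ i p))
    where
    at : ∀ d → embAt i p x d ≡ tree i p x x≢ℓ
    at (yes x≡ℓ) = ⊥-elim (toWitnessFalse x≢ℓ x≡ℓ)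
    at (no _)    = cong (tree i p x) (T-irrelevant _ x≢ℓ)

  role : GV → Role
  role (cyc a)        = cycleRole a
  role (tree i p x _) = Colour.role i p x

  role-emb : ∀ i p x → role (emb i p x) ≡ Colour.role i p x
  role-emb i p x = by-cases (x ≟ ℓ i p)
    where
    by-cases : Dec (x ≡ ℓ i p) → role (emb i p x) ≡ Colour.role i p x
    by-cases (yes x≡ℓ) = subst (λ z → role (emb i p z) ≡ Colour.role i p z) (sym x≡ℓ)
                           (trans (cong role (emb-root i p)) (sym (Colour.role-root i p)))
    by-cases (no x≢ℓ)  = cong role (emb-below-root i p x (fromWitnessFalse x≢ℓ))

  pendant : ∀ a → Dec (T (I a)) → List GV
  pendant a (yes p) = emb a p (Pendant.root-child a p) ∷ []
  pendant a (no _)  = []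

  nbrs : GV → List GV
  nbrs (cyc a)        = cyc (prev a) ∷ cyc (next a) ∷ pendant a (T? (I a))
  nbrs (tree i p x _) = map (emb i p) (Pendant.parent i p x ∷ Pendant.children i p x)

  role-root-child : ∀ i p → Colour.role i p (Pendant.root-child i p) ≡ pendantRole i p
  role-root-child i p = ∷-injectiveˡ (trans (cong (map (Colour.role i p)) (sym (Pendant.children-root i p)))
                                            (Colour.roles-below-root i p))

  valid-cycle : ∀ a d → T? (I a) ≡ d →
                T (Valid (cycleRole a) (cycleRole (prev a) ∷ cycleRole (next a) ∷ map role (pendant a d)))
  valid-cycle a (yes p) _ =
    subst (λ y → T (Valid (cycleRole a) (cycleRole (prev a) ∷ cycleRole (next a) ∷ y ∷ [])))
      (sym (trans (role-emb a p (Pendant.root-child a p)) (role-root-child a p)))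
      (completion-valid (pendantProfile a p) (cycleRole (prev a)) (cycleRole a) (cycleRole (next a))
        (pendantRole a p) (pendantRole-completes a p))
  valid-cycle a (no _) bare =
    bare-valid {cycleRole (prev a)} {cycleRole a} {cycleRole (next a)}
      (subst (λ l → T (admissible l (cycleRole (prev a)) (cycleRole a) (cycleRole (next a))))
             (cong (letterAt a) bare) (cycle-admissible a))

  valid : ∀ u → T (Valid (role u) (map role (nbrs u)))
  valid (cyc a)          = valid-cycle a (T? (I a)) refl
  valid (tree i p x x≢ℓ) =
    subst (T ∘ Valid (Colour.role i p x)) (sym roles-around)
      (Colour.valid-below-root i p (toWitnessFalse x≢ℓ))
    where
    roles-around : map role (map (emb i p) (Pendant.parent i p x ∷ Pendant.children i p x)) ≡
                   map (Colour.role i p) (Pendant.parent i p x ∷ Pendant.children i p x)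
    roles-around = trans (sym (map-∘ (Pendant.parent i p x ∷ Pendant.children i p x)))
                         (map-cong (role-emb i p) (Pendant.parent i p x ∷ Pendant.children i p x))

  pendant-sound : ∀ a d {w} → w ∈ pendant a d → GAdj (cyc a) w
  pendant-sound a (yes p) (here refl) =
    subst (λ u → GAdj u (emb a p (Pendant.root-child a p))) (emb-root a p)
      (treeE a p (ℓ a p) (Pendant.root-child a p) (Pendant.root-edge a p))

  sound : ∀ {u w} → w ∈ nbrs u → GAdj u w
  sound {cyc a} (here refl)         = cycE (inj₂ (toℕ-prev a))
  sound {cyc a} (there (here refl)) = cycE (inj₁ (toℕ-next a))
  sound {cyc a} (there (there w∈))  = pendant-sound a (T? (I a)) w∈
  sound {tree i p x x≢ℓ} w∈ with ∈-map⁻ (emb i p) w∈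
  ... | y , y∈ , refl = subst (λ u → GAdj u (emb i p y)) (emb-below-root i p x x≢ℓ) (treeE i p x y (edge y∈))
    where
    edge : y ∈ Pendant.parent i p x ∷ Pendant.children i p x → Pendant.Edge i p x y
    edge (here refl) = Pendant.parent-edge i p (toWitnessFalse x≢ℓ)
    edge (there y∈)  = Pendant.child-edge i p y∈

  complete : ∀ {u w} → GAdj u w → w ∈ nbrs u
  complete (cycE e) with cycle-neighbour e
  ... | inj₁ refl = there (here refl)
  ... | inj₂ refl = here refl
  complete (treeE i p x y e) = by-cases (x ≟ ℓ i p)
    where
    by-cases : Dec (x ≡ ℓ i p) → emb i p y ∈ nbrs (emb i p x)
    by-cases (yes x≡ℓ) =
      subst (λ u → emb i p y ∈ nbrs u) (sym (trans (cong (emb i p) x≡ℓ) (emb-root i p)))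
        (there (there (subst (λ d → emb i p y ∈ pendant i d) (sym (dec-yes-irr (T? (I i)) T-irrelevant p))
          (here (cong (emb i p) (Pendant.root-edge-unique i p (subst (λ z → Pendant.Edge i p z y) x≡ℓ e)))))))
    by-cases (no x≢ℓ) =
      subst (λ u → emb i p y ∈ nbrs u) (sym (emb-below-root i p x (fromWitnessFalse x≢ℓ)))
        (∈-map⁺ (emb i p) (Pendant.neighbour-below-root i p x≢ℓ e))

  GAdj-sym : ∀ {u w} → GAdj u w → GAdj w u
  GAdj-sym (cycE (inj₁ e))     = cycE (inj₂ e)
  GAdj-sym (cycE (inj₂ e))     = cycE (inj₁ e)
  GAdj-sym (treeE i p x y e)   = treeE i p y x (trans (FinGraph.symm (Tr i p) y x) e)

  crumby : HasCrumby GAdj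
  crumby = isRed ∘ role , crumby-of-valid GAdj-sym nbrs sound complete role valid

proposition3p5 : (k : ℕ) → 3 ≤ k → (I : Fin k → Bool)
    → (Tr : (i : Fin k) → T (I i) → FinGraph)
    → (∀ i p → FinGraph.IsTree (Tr i p))
    → (∀ i p → FinGraph.Subcubic (Tr i p))
    → (∀ i p → 2 ≤ FinGraph.size (Tr i p))
    → (ℓ : (i : Fin k) → (p : T (I i)) → Fin (FinGraph.size (Tr i p)))
    → (∀ i p → FinGraph.IsLeaf (Tr i p) (ℓ i p))
    → HasCrumby (Glue.GAdj k I Tr ℓ)
proposition3p5 (suc m) (s≤s 2≤m) I Tr trees subcubic _ ℓ leaves =
  Assembly.crumby m 2≤m I Tr trees subcubic ℓ leaves
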